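{- Let $\mathcal{H}=(V,H)\in\mathrm{mGU}(2)$ have more than four vertices. Then there exists some $p\in V$ such that the restriction $(V\setminus\{p\},H\cap 2^{V\setminus\{p\}})$ of $\mathcal{H}$ to $V\setminus\{p\}$ is in $\mathrm{mGU}(2)$.
   Context: A simplicial complex is a pair $(V,H)$ with $V$ finite nonempty, $H\subseteq 2^V$ containing all singletons and closed under subsets; its dimension is $\max\{|X|:X\in H\}-1$. $P_{\le k}(V)$ denotes the set of subsets of $V$ with at most $k$ elements. $\mathrm{Pav}(d)$ is the class of complexes of dimension $d$ with $P_{\le d}(V)\subseteq H$. For $(V,H)\in\mathrm{Pav}(d)$, $T(H)=\{T\subseteq V\mid X\cup\{p\}\in H \text{ for all } X\in H\cap P_{\le d}(V),\ X\subseteq T,\ p\in V\setminus T\}$, and $J(T(H))$ is the set of all sets $\{x_1,\dots,x_k\}$ for which there is a chain $T_0\subset\cdots\subset T_k$ in $T(H)$ with $x_i\in T_i\setminus T_{i-1}$. $(V,H)\in\mathrm{Pav}(d)$ goes up if $\dim(V,J(T(H)))>d$; $\mathrm{GU}(d)$ and $\mathrm{NGU}(d)$ are the classes of complexes in $\mathrm{Pav}(d)$ which go up, resp. do not go up. $\mathrm{mGU}(d)$ is the class of $(V,H)\in\mathrm{GU}(d)$ such that $(V,H')\in\mathrm{NGU}(d)$ whenever $H\supsetneq H'\supsetneq P_{\le d}(V)$. -}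

module Defs where

open import Data.Nat using (ℕ; zero; suc; _≤_; _<_)
open import Data.Fin using (Fin; inject₁)
import Data.Fin as Fin
open import Data.Fin.Subset using (Subset; outside; _∈_; _∉_; _⊆_; _⊂_; ∣_∣; ⁅_⁆; _∪_)
open import Data.Bool using (Bool; true)
open import Data.Vec using (insertAt)
open import Data.Product using (Σ; ∃; ∃-syntax; _×_)
open import Relation.Binary.PropositionalEquality using (_≡_)
open import Relation.Nullary using (¬_)
open import Function.Bundles using (_⇔_)

Family : ℕ → Set
Family n = Subset n → Bool

_∈H_ : ∀ {n} → Subset n → Family n → Set
X ∈H H = H X ≡ true

IsComplex : (n : ℕ) → Family n → Set
IsComplex n H =
  (0 < n)
  × (∀ (v : Fin n) → ⁅ v ⁆ ∈H H)
  × (∀ (X Y : Subset n) → X ⊆ Y → Y ∈H H → X ∈H H)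

-- dim (V,H) = d, i.e. max{|X| : X ∈ H} = d + 1.
HasDim : ∀ {n} → ℕ → Family n → Set
HasDim d H = (∃[ X ] (X ∈H H × ∣ X ∣ ≡ suc d)) × (∀ X → X ∈H H → ∣ X ∣ ≤ suc d)

AllSmallIn : ∀ {n} → ℕ → Family n → Set
AllSmallIn k H = ∀ X → ∣ X ∣ ≤ k → X ∈H H

Pav : (d n : ℕ) → Family n → Set
Pav d n H = IsComplex n H × HasDim d H × AllSmallIn d H

InT : ∀ {n} → ℕ → Family n → Subset n → Set
InT {n} d H T = ∀ (X : Subset n) (p : Fin n) →
  X ∈H H → ∣ X ∣ ≤ d → X ⊆ T → p ∉ T → (X ∪ ⁅ p ⁆) ∈H H

-- Y ∈ J(T(H)): there are k, a chain T_0 ⊂ T_1 ⊂ ... ⊂ T_k in T(H) and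
-- x_1,...,x_k with x_i ∈ T_i \ T_{i-1} and Y = {x_1,...,x_k}.
-- (Indices: T i for i : Fin (suc k); x i for i : Fin k stands for x_{i+1}.)
InJ : ∀ {n} → ℕ → Family n → Subset n → Set
InJ {n} d H Y =
  Σ ℕ λ k → Σ (Fin (suc k) → Subset n) λ T → Σ (Fin k → Fin n) λ x →
    (∀ i → InT d H (T i))
    × (∀ (i : Fin k) → T (inject₁ i) ⊂ T (Fin.suc i))
    × (∀ (i : Fin k) → x i ∈ T (Fin.suc i) × x i ∉ T (inject₁ i))
    × (∀ (v : Fin n) → (v ∈ Y) ⇔ (∃[ i ] x i ≡ v))

-- (V,H) goes up: dim(V, J(T(H))) > d, i.e. some Y ∈ J(T(H)) has |Y| - 1 > d.
GoesUp : ∀ {n} → ℕ → Family n → Set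
GoesUp d H = ∃[ Y ] (InJ d H Y × suc d < ∣ Y ∣)

GU : (d n : ℕ) → Family n → Set
GU d n H = Pav d n H × GoesUp d H

NGU : (d n : ℕ) → Family n → Set
NGU d n H = Pav d n H × ¬ GoesUp d H

_⊊F_ : ∀ {n} → Family n → Family n → Set
H' ⊊F H = (∀ X → X ∈H H' → X ∈H H) × (∃[ X ] (X ∈H H × ¬ (X ∈H H')))

SmallProperlyIn : ∀ {n} → ℕ → Family n → Set
SmallProperlyIn d H' = AllSmallIn d H' × (∃[ X ] (X ∈H H' × ¬ (∣ X ∣ ≤ d)))

mGU : (d n : ℕ) → Family n → Set
mGU d n H = GU d n H ×
  (∀ (H' : Family n) → IsComplex n H' → H' ⊊F H → SmallProperlyIn d H' → NGU d n H')

-- Restriction of (V,H), V = Fin (suc n), to V \ {p}, with V \ {p} identified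
-- with Fin n in the order-preserving way (punchIn p): a subset X of V \ {p} is
-- in the restriction iff X (viewed in V, i.e. with p outside) is in H.
restrict : ∀ {n} → Fin (suc n) → Family (suc n) → Family n
restrict p H X = H (insertAt X p outside)

{-# OPTIONS --safe #-}

-- For d = 2, once all pairs are faces, S ∈ T(H) says that every pair in S spans a
-- face with every vertex outside S. A J-set of size four yields sets B ⊂ C in T(H) carrying a
-- chain ⊥ ⊂ {b₁} ⊂ B ⊂ C ⊂ V (a ladder), and the complex generated by B and C (all sets of
-- size ≤ 2 and the triangles meeting B or C in exactly two points) is the least one with
-- B, C ∈ T; it already goes up. So a minimal H is generated by a ladder, and minimality forces
-- a tight ladder (C ∖ B = {c}, B = {b₁, b₂}) or a loose one (C ∖ B and V ∖ C both have two
-- points). Conversely such a complex is minimal: any ladder in T(K) for a subcomplex K forces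
-- K to contain it. Restricting H to V ∖ {p} gives the complex generated by the restricted
-- ladder, and with more than four vertices some p keeps the ladder tight or loose.
module Submission where

open import Defs
open import Data.Bool using (Bool; true; false; _∧_)
open import Data.Nat using (ℕ; zero; suc; _+_; _≤_; _<_; z≤n; s≤s; _≤?_) renaming (_≟_ to _≟ℕ_)
open import Data.Nat.Properties
  using ( module ≤-Reasoning; +-cancelˡ-≡; +-cancelʳ-≡; +-comm; +-suc; +-mono-≤; +-identityʳ
        ; ≤-trans; ≤-reflexive; ≤-antisym; m≤n⇒m≤1+n; ≰⇒>; <-irrefl)
open import Data.Fin using (Fin; zero; suc; punchIn; punchOut; inject₁)
open import Data.Fin.Properties
  using (any?; _≟_; suc-injective; punchIn-injective; punchOut-injective; punchInᵢ≢i; punchIn-punchOut)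
open import Data.Fin.Subset
open import Data.Fin.Subset.Properties
open import Data.Vec using ([]; _∷_; here; there; lookup; insertAt; removeAt)
open import Data.Vec.Properties using ([]=⇒lookup; lookup⇒[]=)
open import Data.Product using (∃-syntax; _×_; _,_; proj₁; proj₂)
open import Data.Sum using (_⊎_; inj₁; inj₂; [_,_])
import Data.Sum
open import Data.Empty using (⊥-elim)
open import Function.Base using (id; _∘_; case_of_)
open import Function.Bundles using (_⇔_; mk⇔; Equivalence)
open import Relation.Nullary using (¬_; Dec; yes; no; does)
open import Relation.Nullary.Decidable
  using ( True; False; toWitness; toWitnessFalse; fromWitnessFalse; dec-true; decidable-stable
        ; _×-dec_; _⊎-dec_; ¬?)
open import Relation.Binary.PropositionalEquality
  using (_≡_; _≢_; _≗_; refl; sym; trans; cong; cong₂; subst; ≢-sym; module ≡-Reasoning)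

private variable n : ℕ

𝟙 : Bool → ℕ
𝟙 true = 1
𝟙 false = 0

∉⇒lookup≡false : ∀ {x : Fin n} {p} → x ∉ p → lookup p x ≡ false
∉⇒lookup≡false {x = x} {p} x∉p with lookup p x in eq
... | true = ⊥-elim (x∉p (lookup⇒[]= x p eq))
... | false = refl

∈∧∉⇒≢ : ∀ {p : Subset n} {x y} → x ∈ p → y ∉ p → x ≢ y
∈∧∉⇒≢ x∈p y∉p refl = y∉p x∈p

𝟙≢2 : ∀ b → 𝟙 b ≢ 2
𝟙≢2 true ()
𝟙≢2 false ()

∣p∪q∣≤∣p∣+∣q∣ : ∀ (p q : Subset n) → ∣ p ∪ q ∣ ≤ ∣ p ∣ + ∣ q ∣
∣p∪q∣≤∣p∣+∣q∣ [] [] = z≤n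
∣p∪q∣≤∣p∣+∣q∣ (true ∷ p) (true ∷ q) rewrite +-suc ∣ p ∣ ∣ q ∣ =
  s≤s (m≤n⇒m≤1+n (∣p∪q∣≤∣p∣+∣q∣ p q))
∣p∪q∣≤∣p∣+∣q∣ (true ∷ p) (false ∷ q) = s≤s (∣p∪q∣≤∣p∣+∣q∣ p q)
∣p∪q∣≤∣p∣+∣q∣ (false ∷ p) (true ∷ q) rewrite +-suc ∣ p ∣ ∣ q ∣ = s≤s (∣p∪q∣≤∣p∣+∣q∣ p q)
∣p∪q∣≤∣p∣+∣q∣ (false ∷ p) (false ∷ q) = ∣p∪q∣≤∣p∣+∣q∣ p q

∣p∪⁅x⁆∣≡1+∣p∣ : ∀ {x : Fin n} (p : Subset n) → x ∉ p → ∣ p ∪ ⁅ x ⁆ ∣ ≡ suc ∣ p ∣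
∣p∪⁅x⁆∣≡1+∣p∣ {x = zero} (true ∷ p) x∉p = ⊥-elim (x∉p here)
∣p∪⁅x⁆∣≡1+∣p∣ {x = zero} (false ∷ p) _ = cong (λ r → suc ∣ r ∣) (∪-identityʳ p)
∣p∪⁅x⁆∣≡1+∣p∣ {x = suc x} (true ∷ p) x∉p = cong suc (∣p∪⁅x⁆∣≡1+∣p∣ p (x∉p ∘ there))
∣p∪⁅x⁆∣≡1+∣p∣ {x = suc x} (false ∷ p) x∉p = ∣p∪⁅x⁆∣≡1+∣p∣ p (x∉p ∘ there)

∣⊥∩p∣≡0 : ∀ (p : Subset n) → ∣ ⊥ ∩ p ∣ ≡ 0
∣⊥∩p∣≡0 {n} p = trans (cong ∣_∣ (∩-zeroˡ p)) (∣⊥∣≡0 n)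

∣⁅x⁆∩p∣≡𝟙[x∈p] : ∀ (x : Fin n) (p : Subset n) → ∣ ⁅ x ⁆ ∩ p ∣ ≡ 𝟙 (lookup p x)
∣⁅x⁆∩p∣≡𝟙[x∈p] zero (true ∷ p) = cong suc (∣⊥∩p∣≡0 p)
∣⁅x⁆∩p∣≡𝟙[x∈p] zero (false ∷ p) = ∣⊥∩p∣≡0 p
∣⁅x⁆∩p∣≡𝟙[x∈p] (suc x) (_ ∷ p) = ∣⁅x⁆∩p∣≡𝟙[x∈p] x p

∣p∪⁅x⁆∩q∣≡∣p∩q∣+𝟙[x∈q] : ∀ {x : Fin n} (p q : Subset n) → x ∉ p →
  ∣ (p ∪ ⁅ x ⁆) ∩ q ∣ ≡ ∣ p ∩ q ∣ + 𝟙 (lookup q x)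
∣p∪⁅x⁆∩q∣≡∣p∩q∣+𝟙[x∈q] {x = zero} (true ∷ p) _ x∉p = ⊥-elim (x∉p here)
∣p∪⁅x⁆∩q∣≡∣p∩q∣+𝟙[x∈q] {x = zero} (false ∷ p) (b ∷ q) _ rewrite ∪-identityʳ p with b
... | true = +-comm 1 ∣ p ∩ q ∣
... | false = sym (+-identityʳ ∣ p ∩ q ∣)
∣p∪⁅x⁆∩q∣≡∣p∩q∣+𝟙[x∈q] {x = suc x} (a ∷ p) (b ∷ q) x∉p with a | b | ∣p∪⁅x⁆∩q∣≡∣p∩q∣+𝟙[x∈q] p q (x∉p ∘ there)
... | true  | true  | ih = cong suc ih
... | true  | false | ih = ih
... | false | true  | ih = ih
... | false | false | ih = ih

∣p∣≡∣p∩q∣+∣p∩∁q∣ : ∀ (p q : Subset n) → ∣ p ∣ ≡ ∣ p ∩ q ∣ + ∣ p ∩ ∁ q ∣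
∣p∣≡∣p∩q∣+∣p∩∁q∣ [] [] = refl
∣p∣≡∣p∩q∣+∣p∩∁q∣ (true ∷ p) (true ∷ q) = cong suc (∣p∣≡∣p∩q∣+∣p∩∁q∣ p q)
∣p∣≡∣p∩q∣+∣p∩∁q∣ (true ∷ p) (false ∷ q) =
  trans (cong suc (∣p∣≡∣p∩q∣+∣p∩∁q∣ p q)) (sym (+-suc ∣ p ∩ q ∣ ∣ p ∩ ∁ q ∣))
∣p∣≡∣p∩q∣+∣p∩∁q∣ (false ∷ p) (_ ∷ q) = ∣p∣≡∣p∩q∣+∣p∩∁q∣ p q

p⊆q⇒∣q∣≤∣p∣⇒p≡q : ∀ {p q : Subset n} → p ⊆ q → ∣ q ∣ ≤ ∣ p ∣ → p ≡ q
p⊆q⇒∣q∣≤∣p∣⇒p≡q {p = []} {[]} _ _ = refl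
p⊆q⇒∣q∣≤∣p∣⇒p≡q {p = true ∷ p} {true ∷ q} p⊆q (s≤s ∣q∣≤∣p∣) =
  cong (true ∷_) (p⊆q⇒∣q∣≤∣p∣⇒p≡q (drop-∷-⊆ p⊆q) ∣q∣≤∣p∣)
p⊆q⇒∣q∣≤∣p∣⇒p≡q {p = true ∷ p} {false ∷ q} p⊆q _ with p⊆q here
... | ()
p⊆q⇒∣q∣≤∣p∣⇒p≡q {p = false ∷ p} {true ∷ q} p⊆q ∣q∣<∣p∣ =
  ⊥-elim (<-irrefl refl (≤-trans ∣q∣<∣p∣ (p⊆q⇒∣p∣≤∣q∣ (drop-∷-⊆ p⊆q))))
p⊆q⇒∣q∣≤∣p∣⇒p≡q {p = false ∷ p} {false ∷ q} p⊆q ∣q∣≤∣p∣ =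
  cong (false ∷_) (p⊆q⇒∣q∣≤∣p∣⇒p≡q (drop-∷-⊆ p⊆q) ∣q∣≤∣p∣)

1≤∣p∣⇒∃∈ : ∀ (p : Subset n) → 1 ≤ ∣ p ∣ → ∃[ x ] x ∈ p
1≤∣p∣⇒∃∈ (true ∷ p) _ = zero , here
1≤∣p∣⇒∃∈ (false ∷ p) h = let x , x∈p = 1≤∣p∣⇒∃∈ p h in suc x , there x∈p

2≤∣p∣⇒∃≢∈ : ∀ (p : Subset n) → 2 ≤ ∣ p ∣ → ∃[ x ] ∃[ y ] (x ∈ p × y ∈ p × x ≢ y)
2≤∣p∣⇒∃≢∈ (true ∷ p) (s≤s h) = let y , y∈p = 1≤∣p∣⇒∃∈ p h in zero , suc y , here , there y∈p , λ ()
2≤∣p∣⇒∃≢∈ (false ∷ p) h =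
  let x , y , x∈p , y∈p , x≢y = 2≤∣p∣⇒∃≢∈ p h
  in suc x , suc y , there x∈p , there y∈p , x≢y ∘ suc-injective

edge : Fin n → Fin n → Subset n
edge u v = ⁅ u ⁆ ∪ ⁅ v ⁆

triangle : Fin n → Fin n → Fin n → Subset n
triangle u v w = edge u v ∪ ⁅ w ⁆

Distinct : Fin n → Fin n → Fin n → Set
Distinct u v w = u ≢ v × u ≢ w × v ≢ w

module _ {u v : Fin n} where

  u∈edge : u ∈ edge u v
  u∈edge = x∈p∪q⁺ (inj₁ (x∈⁅x⁆ u))

  v∈edge : v ∈ edge u v
  v∈edge = x∈p∪q⁺ (inj₂ (x∈⁅x⁆ v))

  ∈edge⁻ : ∀ {x} → x ∈ edge u v → x ≡ u ⊎ x ≡ v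
  ∈edge⁻ x∈ with x∈p∪q⁻ ⁅ u ⁆ ⁅ v ⁆ x∈
  ... | inj₁ x∈⁅u⁆ = inj₁ (x∈⁅y⁆⇒x≡y u x∈⁅u⁆)
  ... | inj₂ x∈⁅v⁆ = inj₂ (x∈⁅y⁆⇒x≡y v x∈⁅v⁆)

  ∉edge : ∀ {x} → x ≢ u → x ≢ v → x ∉ edge u v
  ∉edge x≢u x≢v x∈ = [ x≢u , x≢v ] (∈edge⁻ x∈)

  edge⊆ : ∀ {p} → u ∈ p → v ∈ p → edge u v ⊆ p
  edge⊆ u∈p v∈p x∈ with ∈edge⁻ x∈
  ... | inj₁ refl = u∈p
  ... | inj₂ refl = v∈p

  ∣edge∣≡2 : u ≢ v → ∣ edge u v ∣ ≡ 2
  ∣edge∣≡2 u≢v =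
    trans (∣p∪⁅x⁆∣≡1+∣p∣ ⁅ u ⁆ (u≢v ∘ sym ∘ x∈⁅y⁆⇒x≡y u)) (cong suc (∣⁅x⁆∣≡1 u))

module _ {u v w : Fin n} where

  u∈triangle : u ∈ triangle u v w
  u∈triangle = x∈p∪q⁺ (inj₁ u∈edge)

  v∈triangle : v ∈ triangle u v w
  v∈triangle = x∈p∪q⁺ (inj₁ v∈edge)

  w∈triangle : w ∈ triangle u v w
  w∈triangle = x∈p∪q⁺ (inj₂ (x∈⁅x⁆ w))

  ∈triangle⁻ : ∀ {x} → x ∈ triangle u v w → x ≡ u ⊎ x ≡ v ⊎ x ≡ w
  ∈triangle⁻ x∈ with x∈p∪q⁻ (edge u v) ⁅ w ⁆ x∈
  ... | inj₁ x∈edge = Data.Sum.map₂ inj₁ (∈edge⁻ x∈edge)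
  ... | inj₂ x∈⁅w⁆ = inj₂ (inj₂ (x∈⁅y⁆⇒x≡y w x∈⁅w⁆))

  triangle⊆ : ∀ {p} → u ∈ p → v ∈ p → w ∈ p → triangle u v w ⊆ p
  triangle⊆ u∈p v∈p w∈p x∈ with ∈triangle⁻ x∈
  ... | inj₁ refl = u∈p
  ... | inj₂ (inj₁ refl) = v∈p
  ... | inj₂ (inj₂ refl) = w∈p

  w∉edge : Distinct u v w → w ∉ edge u v
  w∉edge (_ , u≢w , v≢w) = ∉edge (u≢w ∘ sym) (v≢w ∘ sym)

  ∣triangle∣≡3 : Distinct u v w → ∣ triangle u v w ∣ ≡ 3
  ∣triangle∣≡3 d@(u≢v , _) = trans (∣p∪⁅x⁆∣≡1+∣p∣ (edge u v) (w∉edge d)) (cong suc (∣edge∣≡2 u≢v))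

∣edge∣≤2 : ∀ (u v : Fin n) → ∣ edge u v ∣ ≤ 2
∣edge∣≤2 u v = ≤-trans (∣p∪q∣≤∣p∣+∣q∣ ⁅ u ⁆ ⁅ v ⁆) (≤-reflexive (cong₂ _+_ (∣⁅x⁆∣≡1 u) (∣⁅x⁆∣≡1 v)))

∣triangle∣≤3 : ∀ (u v w : Fin n) → ∣ triangle u v w ∣ ≤ 3
∣triangle∣≤3 u v w =
  ≤-trans (∣p∪q∣≤∣p∣+∣q∣ (edge u v) ⁅ w ⁆) (+-mono-≤ (∣edge∣≤2 u v) (≤-reflexive (∣⁅x⁆∣≡1 w)))

count₃ : Subset n → Fin n → Fin n → Fin n → ℕ
count₃ p u v w = 𝟙 (lookup p u) + 𝟙 (lookup p v) + 𝟙 (lookup p w)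

∣triangle∩p∣≡count₃ : ∀ {u v w : Fin n} (p : Subset n) → Distinct u v w →
  ∣ triangle u v w ∩ p ∣ ≡ count₃ p u v w
∣triangle∩p∣≡count₃ {u = u} {v} {w} p d@(u≢v , _) = begin
  ∣ triangle u v w ∩ p ∣
    ≡⟨ ∣p∪⁅x⁆∩q∣≡∣p∩q∣+𝟙[x∈q] (edge u v) p (w∉edge d) ⟩
  ∣ edge u v ∩ p ∣ + 𝟙 (lookup p w)
    ≡⟨ cong (_+ 𝟙 (lookup p w)) (∣p∪⁅x⁆∩q∣≡∣p∩q∣+𝟙[x∈q] ⁅ u ⁆ p (u≢v ∘ sym ∘ x∈⁅y⁆⇒x≡y u)) ⟩
  ∣ ⁅ u ⁆ ∩ p ∣ + 𝟙 (lookup p v) + 𝟙 (lookup p w)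
    ≡⟨ cong (λ k → k + 𝟙 (lookup p v) + 𝟙 (lookup p w)) (∣⁅x⁆∩p∣≡𝟙[x∈p] u p) ⟩
  count₃ p u v w
    ∎
  where open ≡-Reasoning

splitTriangle : ∀ {Z S : Subset n} → ∣ Z ∣ ≡ 3 → ∣ Z ∩ S ∣ ≡ 2 →
  ∃[ u ] ∃[ v ] ∃[ w ] (Distinct u v w × u ∈ S × v ∈ S × w ∉ S × triangle u v w ≡ Z)
splitTriangle {Z = Z} {S} ∣Z∣≡3 ∣Z∩S∣≡2
  with 2≤∣p∣⇒∃≢∈ (Z ∩ S) (≤-reflexive (sym ∣Z∩S∣≡2))
     | 1≤∣p∣⇒∃∈ (Z ∩ ∁ S) (≤-reflexive (sym ∣Z∖S∣≡1))
  where
  ∣Z∖S∣≡1 : ∣ Z ∩ ∁ S ∣ ≡ 1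
  ∣Z∖S∣≡1 = +-cancelˡ-≡ 2 _ 1 (begin
    2 + ∣ Z ∩ ∁ S ∣          ≡⟨ cong (_+ ∣ Z ∩ ∁ S ∣) ∣Z∩S∣≡2 ⟨
    ∣ Z ∩ S ∣ + ∣ Z ∩ ∁ S ∣  ≡⟨ ∣p∣≡∣p∩q∣+∣p∩∁q∣ Z S ⟨
    ∣ Z ∣                    ≡⟨ ∣Z∣≡3 ⟩
    3                        ∎)
    where open ≡-Reasoning
... | u , v , u∈ , v∈ , u≢v | w , w∈ =
  u , v , w , d , u∈S , v∈S , w∉S ,
  p⊆q⇒∣q∣≤∣p∣⇒p≡q (triangle⊆ u∈Z v∈Z w∈Z) (≤-reflexive (trans ∣Z∣≡3 (sym (∣triangle∣≡3 d))))
  where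
  u∈Z = proj₁ (x∈p∩q⁻ Z S u∈)
  v∈Z = proj₁ (x∈p∩q⁻ Z S v∈)
  w∈Z = proj₁ (x∈p∩q⁻ Z (∁ S) w∈)
  u∈S = proj₂ (x∈p∩q⁻ Z S u∈)
  v∈S = proj₂ (x∈p∩q⁻ Z S v∈)
  w∉S = x∈∁p⇒x∉p (proj₂ (x∈p∩q⁻ Z (∁ S) w∈))
  d : Distinct u v w
  d = u≢v , (λ { refl → w∉S u∈S }) , (λ { refl → w∉S v∈S })

-- T(H) in dimension two

-- S ∈ T(H) for d = 2 once all sets of size ≤ 2 are faces: subsets X ⊆ S with |X| ≤ 1
-- extend trivially, so only pairs matter.
PairsExtend : Family n → Subset n → Set
PairsExtend {n} H S =
  ∀ (u v w : Fin n) → Distinct u v w → u ∈ S → v ∈ S → w ∉ S → triangle u v w ∈H H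

module _ {H : Family n} (small : AllSmallIn 2 H) where

  InT⇒PairsExtend : ∀ {S} → InT 2 H S → PairsExtend H S
  InT⇒PairsExtend S∈T u v w _ u∈S v∈S =
    S∈T (edge u v) w (small (edge u v) (∣edge∣≤2 u v)) (∣edge∣≤2 u v) (edge⊆ u∈S v∈S)

  PairsExtend⇒InT : ∀ {S} → PairsExtend H S → InT 2 H S
  PairsExtend⇒InT {S} ext X p _ ∣X∣≤2 X⊆S p∉S with ∣ X ∣ ≤? 1
  ... | yes ∣X∣≤1 = small (X ∪ ⁅ p ⁆)
    (≤-trans (∣p∪q∣≤∣p∣+∣q∣ X ⁅ p ⁆) (+-mono-≤ ∣X∣≤1 (≤-reflexive (∣⁅x⁆∣≡1 p))))
  ... | no ∣X∣≰1 with 2≤∣p∣⇒∃≢∈ X (≰⇒> ∣X∣≰1)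
  ... | u , v , u∈X , v∈X , u≢v =
    subst (λ Y → (Y ∪ ⁅ p ⁆) ∈H H) edge≡X
      (ext u v p (u≢v , ≢p u∈X , ≢p v∈X) (X⊆S u∈X) (X⊆S v∈X) p∉S)
    where
    edge≡X : edge u v ≡ X
    edge≡X = p⊆q⇒∣q∣≤∣p∣⇒p≡q (edge⊆ u∈X v∈X) (≤-trans ∣X∣≤2 (≤-reflexive (sym (∣edge∣≡2 u≢v))))
    ≢p : ∀ {x} → x ∈ X → x ≢ p
    ≢p x∈X refl = p∉S (X⊆S x∈X)

PairsExtend-⊥ : ∀ (H : Family n) → PairsExtend H ⊥
PairsExtend-⊥ H u _ _ _ u∈⊥ = ⊥-elim (∉⊥ u∈⊥)

PairsExtend-⊤ : ∀ (H : Family n) → PairsExtend H ⊤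
PairsExtend-⊤ H _ _ _ _ _ _ w∉⊤ = ⊥-elim (w∉⊤ ∈⊤)

PairsExtend-⁅⁆ : ∀ (H : Family n) a → PairsExtend H ⁅ a ⁆
PairsExtend-⁅⁆ H a u v _ (u≢v , _) u∈ v∈ =
  ⊥-elim (u≢v (trans (x∈⁅y⁆⇒x≡y a u∈) (sym (x∈⁅y⁆⇒x≡y a v∈))))

PairsExtend-⊆ : ∀ {K H : Family n} → (∀ Z → Z ∈H K → Z ∈H H) →
  ∀ {S} → PairsExtend K S → PairsExtend H S
PairsExtend-⊆ K⊆H ext u v w d u∈S v∈S w∉S = K⊆H _ (ext u v w d u∈S v∈S w∉S)

-- The complex generated by a ladder

GeneratedFace : Subset n → Subset n → Subset n → Set
GeneratedFace B C Z = ∣ Z ∣ ≤ 2 ⊎ (∣ Z ∣ ≡ 3 × (∣ Z ∩ B ∣ ≡ 2 ⊎ ∣ Z ∩ C ∣ ≡ 2))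

generatedFace? : ∀ (B C Z : Subset n) → Dec (GeneratedFace B C Z)
generatedFace? B C Z =
  ∣ Z ∣ ≤? 2 ⊎-dec (∣ Z ∣ ≟ℕ 3 ×-dec (∣ Z ∩ B ∣ ≟ℕ 2 ⊎-dec ∣ Z ∩ C ∣ ≟ℕ 2))

-- The least family containing all sets of size ≤ 2 for which B and C lie in T
-- (see Generated⊆ and GeneratedByLadder.B-extends / C-extends).
Generated : Subset n → Subset n → Family n
Generated B C Z = does (generatedFace? B C Z)

does≡true⇒ : ∀ {A : Set} (a? : Dec A) → does a? ≡ true → A
does≡true⇒ (yes a) _ = a

module _ (B C : Subset n) where

  ∈Generated⁺ : ∀ Z → GeneratedFace B C Z → Z ∈H Generated B C
  ∈Generated⁺ Z = dec-true (generatedFace? B C Z)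

  ∈Generated⁻ : ∀ Z → Z ∈H Generated B C → GeneratedFace B C Z
  ∈Generated⁻ Z = does≡true⇒ (generatedFace? B C Z)

  ∈Generated-small : ∀ Z → ∣ Z ∣ ≤ 2 → Z ∈H Generated B C
  ∈Generated-small Z = ∈Generated⁺ Z ∘ inj₁

  ∈Generated-bound : ∀ Z → Z ∈H Generated B C → ∣ Z ∣ ≤ 3
  ∈Generated-bound Z Z∈ with ∈Generated⁻ Z Z∈
  ... | inj₁ ∣Z∣≤2 = m≤n⇒m≤1+n ∣Z∣≤2
  ... | inj₂ (∣Z∣≡3 , _) = ≤-reflexive ∣Z∣≡3

  module _ {u v w : Fin n} (d : Distinct u v w) where

    triangle∈Generated⁺ : count₃ B u v w ≡ 2 ⊎ count₃ C u v w ≡ 2 → triangle u v w ∈H Generated B C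
    triangle∈Generated⁺ counts = ∈Generated⁺ (triangle u v w) (inj₂ (∣triangle∣≡3 d ,
      Data.Sum.map (trans (∣triangle∩p∣≡count₃ B d)) (trans (∣triangle∩p∣≡count₃ C d)) counts))

    triangle∈Generated⁻ : triangle u v w ∈H Generated B C → count₃ B u v w ≡ 2 ⊎ count₃ C u v w ≡ 2
    triangle∈Generated⁻ t∈ with ∈Generated⁻ (triangle u v w) t∈
    ... | inj₁ ∣t∣≤2 = ⊥-elim (<-irrefl (∣triangle∣≡3 d) (s≤s ∣t∣≤2))
    ... | inj₂ (_ , counts) =
      Data.Sum.map (trans (sym (∣triangle∩p∣≡count₃ B d))) (trans (sym (∣triangle∩p∣≡count₃ C d))) counts

data Zone : Set where
  inner gap outer : Zone

inB inC : Zone → Bool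
inB inner = true
inB gap = false
inB outer = false
inC inner = true
inC gap = true
inC outer = false

#B #C : Zone → Zone → Zone → ℕ
#B zu zv zw = 𝟙 (inB zu) + 𝟙 (inB zv) + 𝟙 (inB zw)
#C zu zv zw = 𝟙 (inC zu) + 𝟙 (inC zv) + 𝟙 (inC zw)

data ZoneOf (B C : Subset n) (x : Fin n) : Zone → Set where
  inner : x ∈ B → x ∈ C → ZoneOf B C x inner
  gap : x ∉ B → x ∈ C → ZoneOf B C x gap
  outer : x ∉ B → x ∉ C → ZoneOf B C x outer

module _ {B C : Subset n} where

  zoneOf : B ⊆ C → ∀ x → ∃[ z ] ZoneOf B C x z
  zoneOf B⊆C x with x ∈? B | x ∈? C
  ... | yes x∈B | _ = inner , inner x∈B (B⊆C x∈B)
  ... | no x∉B | yes x∈C = gap , gap x∉B x∈C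
  ... | no x∉B | no x∉C = outer , outer x∉B x∉C

  lookupB : ∀ {x z} → ZoneOf B C x z → lookup B x ≡ inB z
  lookupB (inner x∈B _) = []=⇒lookup x∈B
  lookupB (gap x∉B _) = ∉⇒lookup≡false x∉B
  lookupB (outer x∉B _) = ∉⇒lookup≡false x∉B

  lookupC : ∀ {x z} → ZoneOf B C x z → lookup C x ≡ inC z
  lookupC (inner _ x∈C) = []=⇒lookup x∈C
  lookupC (gap _ x∈C) = []=⇒lookup x∈C
  lookupC (outer _ x∉C) = ∉⇒lookup≡false x∉C

  module _ {u v w zu zv zw} (d : Distinct u v w)
    (at-u : ZoneOf B C u zu) (at-v : ZoneOf B C v zv) (at-w : ZoneOf B C w zw) where

    private
      countB≡ : count₃ B u v w ≡ #B zu zv zw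
      countB≡ rewrite lookupB at-u | lookupB at-v | lookupB at-w = refl
      countC≡ : count₃ C u v w ≡ #C zu zv zw
      countC≡ rewrite lookupC at-u | lookupC at-v | lookupC at-w = refl

    -- Once the zones are known, the side conditions are closed decidable tests, so Agda
    -- discharges these implicit arguments by itself.
    triangle∈Generated : {_ : True (#B zu zv zw ≟ℕ 2 ⊎-dec #C zu zv zw ≟ℕ 2)} →
      triangle u v w ∈H Generated B C
    triangle∈Generated {counts} =
      triangle∈Generated⁺ B C d (Data.Sum.map (trans countB≡) (trans countC≡) (toWitness counts))

    triangle∉Generated : {_ : False (#B zu zv zw ≟ℕ 2)} {_ : False (#C zu zv zw ≟ℕ 2)} →
      ¬ triangle u v w ∈H Generated B C
    triangle∉Generated {≢B} {≢C} t∈ with triangle∈Generated⁻ B C d t∈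
    ... | inj₁ ≡B = toWitnessFalse ≢B (trans (sym countB≡) ≡B)
    ... | inj₂ ≡C = toWitnessFalse ≢C (trans (sym countC≡) ≡C)

-- A ladder on B ⊆ C carries the chain ⊥ ⊂ ⁅ b₁ ⁆ ⊂ B ⊂ C ⊂ ⊤, whose J-set is {b₁, b₂, c, w}.
record Ladder (B C : Subset n) : Set where
  field
    B⊆C : B ⊆ C
    b₁ b₂ c w : Fin n
    b₁∈B : b₁ ∈ B
    b₂∈B : b₂ ∈ B
    b₁≢b₂ : b₁ ≢ b₂
    c∈C : c ∈ C
    c∉B : c ∉ B
    w∉C : w ∉ C

  w∉B : w ∉ B
  w∉B = w∉C ∘ B⊆C

  distinct-b₁b₂c : Distinct b₁ b₂ c
  distinct-b₁b₂c = b₁≢b₂ , ∈∧∉⇒≢ b₁∈B c∉B , ∈∧∉⇒≢ b₂∈B c∉B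

  distinct-b₁b₂w : Distinct b₁ b₂ w
  distinct-b₁b₂w = b₁≢b₂ , ∈∧∉⇒≢ b₁∈B w∉B , ∈∧∉⇒≢ b₂∈B w∉B

  c≢w : c ≢ w
  c≢w = ∈∧∉⇒≢ c∈C w∉C

  innerZone : ∀ {x} → x ∈ B → ZoneOf B C x inner
  innerZone x∈B = inner x∈B (B⊆C x∈B)

  outerZone : ∀ {x} → x ∉ C → ZoneOf B C x outer
  outerZone x∉C = outer (x∉C ∘ B⊆C) x∉C

module LadderChain {B C : Subset n} (L : Ladder B C) where
  open Ladder L

  chain : Fin 5 → Subset n
  chain zero = ⊥
  chain (suc zero) = ⁅ b₁ ⁆
  chain (suc (suc zero)) = B
  chain (suc (suc (suc zero))) = C
  chain (suc (suc (suc (suc zero)))) = ⊤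

  xs : Fin 4 → Fin n
  xs zero = b₁
  xs (suc zero) = b₂
  xs (suc (suc zero)) = c
  xs (suc (suc (suc zero))) = w

  xs-steps : ∀ i → xs i ∈ chain (suc i) × xs i ∉ chain (inject₁ i)
  xs-steps zero = x∈⁅x⁆ b₁ , ∉⊥
  xs-steps (suc zero) = b₂∈B , b₁≢b₂ ∘ sym ∘ x∈⁅y⁆⇒x≡y b₁
  xs-steps (suc (suc zero)) = c∈C , c∉B
  xs-steps (suc (suc (suc zero))) = ∈⊤ , w∉C

  chain-strict : ∀ i → chain (inject₁ i) ⊂ chain (suc i)
  chain-strict i = ⊆-step i , xs i , xs-steps i
    where
    ⊆-step : ∀ i → chain (inject₁ i) ⊆ chain (suc i)
    ⊆-step zero = ⊥⊆
    ⊆-step (suc zero) x∈ = subst (_∈ B) (sym (x∈⁅y⁆⇒x≡y b₁ x∈)) b₁∈B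
    ⊆-step (suc (suc zero)) = B⊆C
    ⊆-step (suc (suc (suc zero))) = ⊆⊤

  J : Subset n
  J = triangle b₁ b₂ c ∪ ⁅ w ⁆

  J⇔ : ∀ v → (v ∈ J) ⇔ (∃[ i ] xs i ≡ v)
  J⇔ v = mk⇔ to from
    where
    to : v ∈ J → ∃[ i ] xs i ≡ v
    to v∈J with x∈p∪q⁻ (triangle b₁ b₂ c) ⁅ w ⁆ v∈J
    ... | inj₂ v∈⁅w⁆ = suc (suc (suc zero)) , sym (x∈⁅y⁆⇒x≡y w v∈⁅w⁆)
    ... | inj₁ v∈t with ∈triangle⁻ v∈t
    ... | inj₁ refl = zero , refl
    ... | inj₂ (inj₁ refl) = suc zero , refl
    ... | inj₂ (inj₂ refl) = suc (suc zero) , refl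
    from : ∃[ i ] xs i ≡ v → v ∈ J
    from (zero , refl) = x∈p∪q⁺ (inj₁ u∈triangle)
    from (suc zero , refl) = x∈p∪q⁺ (inj₁ v∈triangle)
    from (suc (suc zero) , refl) = x∈p∪q⁺ (inj₁ w∈triangle)
    from (suc (suc (suc zero)) , refl) = x∈p∪q⁺ (inj₂ (x∈⁅x⁆ w))

  3<∣J∣ : 3 < ∣ J ∣
  3<∣J∣ = ≤-reflexive (sym (trans (∣p∪⁅x⁆∣≡1+∣p∣ (triangle b₁ b₂ c) w∉b₁b₂c)
                                  (cong suc (∣triangle∣≡3 distinct-b₁b₂c))))
    where
    w∉b₁b₂c : w ∉ triangle b₁ b₂ c
    w∉b₁b₂c = w∉C ∘ triangle⊆ (B⊆C b₁∈B) (B⊆C b₂∈B) c∈C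

module GeneratedByLadder {G : Family n} {B C : Subset n} (G≗ : G ≗ Generated B C) (L : Ladder B C) where
  open Ladder L

  Generated⊆G : ∀ Z → Z ∈H Generated B C → Z ∈H G
  Generated⊆G Z = trans (G≗ Z)

  G⊆Generated : ∀ Z → Z ∈H G → Z ∈H Generated B C
  G⊆Generated Z = trans (sym (G≗ Z))

  small : AllSmallIn 2 G
  small Z = Generated⊆G Z ∘ ∈Generated-small B C Z

  bound : ∀ Z → Z ∈H G → ∣ Z ∣ ≤ 3
  bound Z = ∈Generated-bound B C Z ∘ G⊆Generated Z

  isComplex : IsComplex n G
  isComplex = nonempty b₁ , (λ v → small ⁅ v ⁆ (≤-trans (≤-reflexive (∣⁅x⁆∣≡1 v)) (s≤s z≤n))) ,
              downClosed
    where
    nonempty : Fin n → 0 < n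
    nonempty zero = s≤s z≤n
    nonempty (suc _) = s≤s z≤n
    downClosed : ∀ X Y → X ⊆ Y → Y ∈H G → X ∈H G
    downClosed X Y X⊆Y Y∈G with ∣ X ∣ ≤? 2
    ... | yes ∣X∣≤2 = small X ∣X∣≤2
    ... | no ∣X∣≰2 = subst (_∈H G) (sym (p⊆q⇒∣q∣≤∣p∣⇒p≡q X⊆Y (≤-trans (bound Y Y∈G) (≰⇒> ∣X∣≰2)))) Y∈G

  B-extends : PairsExtend G B
  B-extends u v w d u∈B v∈B w∉B = Generated⊆G _ (triangle∈Generated⁺ B C d (inj₁ count≡2))
    where
    count≡2 : count₃ B u v w ≡ 2
    count≡2 rewrite []=⇒lookup u∈B | []=⇒lookup v∈B | ∉⇒lookup≡false w∉B = refl

  C-extends : PairsExtend G C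
  C-extends u v w d u∈C v∈C w∉C = Generated⊆G _ (triangle∈Generated⁺ B C d (inj₂ count≡2))
    where
    count≡2 : count₃ C u v w ≡ 2
    count≡2 rewrite []=⇒lookup u∈C | []=⇒lookup v∈C | ∉⇒lookup≡false w∉C = refl

  b₁b₂w∈G : triangle b₁ b₂ w ∈H G
  b₁b₂w∈G = B-extends b₁ b₂ w distinct-b₁b₂w b₁∈B b₂∈B w∉B

  hasDim : HasDim 2 G
  hasDim = (triangle b₁ b₂ w , b₁b₂w∈G , ∣triangle∣≡3 distinct-b₁b₂w) , bound

  pav : Pav 2 n G
  pav = isComplex , hasDim , small

  smallProperlyIn : SmallProperlyIn 2 G
  smallProperlyIn = small , triangle b₁ b₂ w , b₁b₂w∈G ,
    λ ∣t∣≤2 → <-irrefl (∣triangle∣≡3 distinct-b₁b₂w) (s≤s ∣t∣≤2)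

  goesUp : GoesUp 2 G
  goesUp = J , (4 , chain , xs , chain∈T , chain-strict , xs-steps , J⇔) , 3<∣J∣
    where
    open LadderChain L
    chain∈T : ∀ i → InT 2 G (chain i)
    chain∈T i = PairsExtend⇒InT small (extends i)
      where
      extends : ∀ i → PairsExtend G (chain i)
      extends zero = PairsExtend-⊥ G
      extends (suc zero) = PairsExtend-⁅⁆ G b₁
      extends (suc (suc zero)) = B-extends
      extends (suc (suc (suc zero))) = C-extends
      extends (suc (suc (suc (suc zero)))) = PairsExtend-⊤ G

record LadderIn (G : Family n) : Set where
  field
    {B C} : Subset n
    ladder : Ladder B C
    B-extends : PairsExtend G B
    C-extends : PairsExtend G C

image : ∀ {k} → (Fin k → Fin n) → Subset n
image {k = zero} _ = ⊥
image {k = suc k} f = ⁅ f zero ⁆ ∪ image (f ∘ suc)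

∣image∣≤k : ∀ {k} (f : Fin k → Fin n) → ∣ image f ∣ ≤ k
∣image∣≤k {n} {zero} _ = ≤-reflexive (∣⊥∣≡0 n)
∣image∣≤k {k = suc k} f =
  ≤-trans (∣p∪q∣≤∣p∣+∣q∣ ⁅ f zero ⁆ (image (f ∘ suc)))
          (+-mono-≤ (≤-reflexive (∣⁅x⁆∣≡1 (f zero))) (∣image∣≤k (f ∘ suc)))

f∈image : ∀ {k} (f : Fin k → Fin n) i → f i ∈ image f
f∈image f zero = x∈p∪q⁺ (inj₁ (x∈⁅x⁆ (f zero)))
f∈image f (suc i) = x∈p∪q⁺ (inj₂ (f∈image (f ∘ suc) i))

-- A J-set of size four comes from a chain of length at least four, whose middle steps form a ladder.
ladderOfGoesUp : ∀ {G : Family n} → AllSmallIn 2 G → GoesUp 2 G → LadderIn G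
ladderOfGoesUp {n} {G} small (Y , (k , T , x , T∈T , strict , steps , Y⇔) , 3<∣Y∣) =
  fourSteps k T x T∈T strict steps 3<k
  where
  Y⊆image : Y ⊆ image x
  Y⊆image {v} v∈Y with Equivalence.to (Y⇔ v) v∈Y
  ... | i , refl = f∈image x i

  3<k : 3 < k
  3<k = ≤-trans 3<∣Y∣ (≤-trans (p⊆q⇒∣p∣≤∣q∣ Y⊆image) (∣image∣≤k x))

  fourSteps : ∀ k (T : Fin (suc k) → Subset n) (x : Fin k → Fin n) →
    (∀ i → InT 2 G (T i)) → (∀ i → T (inject₁ i) ⊂ T (suc i)) →
    (∀ i → x i ∈ T (suc i) × x i ∉ T (inject₁ i)) → 3 < k → LadderIn G
  fourSteps (suc (suc (suc (suc _)))) T x T∈T strict steps _ = record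
    { ladder = record
      { B⊆C = proj₁ (strict 2F)
      ; b₁ = x 0F ; b₂ = x 1F ; c = x 2F ; w = x 3F
      ; b₁∈B = proj₁ (strict 1F) (proj₁ (steps 0F))
      ; b₂∈B = proj₁ (steps 1F)
      ; b₁≢b₂ = λ x₀≡x₁ → proj₂ (steps 1F) (subst (_∈ T 1F) x₀≡x₁ (proj₁ (steps 0F)))
      ; c∈C = proj₁ (steps 2F)
      ; c∉B = proj₂ (steps 2F)
      ; w∉C = proj₂ (steps 3F)
      }
    ; B-extends = InT⇒PairsExtend small (T∈T 2F)
    ; C-extends = InT⇒PairsExtend small (T∈T 3F)
    }
    where
    0F 1F 2F 3F : ∀ {m} → Fin (4 + m)
    0F = zero
    1F = suc zero
    2F = suc (suc zero)
    3F = suc (suc (suc zero))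
  fourSteps 1 _ _ _ _ _ (s≤s ())
  fourSteps 2 _ _ _ _ _ (s≤s (s≤s ()))
  fourSteps 3 _ _ _ _ _ (s≤s (s≤s (s≤s ())))

PairsExtend-split : ∀ {K : Family n} {S} → PairsExtend K S → ∀ Z → ∣ Z ∣ ≡ 3 → ∣ Z ∩ S ∣ ≡ 2 → Z ∈H K
PairsExtend-split {K = K} S-ext Z ∣Z∣≡3 ∣Z∩S∣≡2 with splitTriangle ∣Z∣≡3 ∣Z∩S∣≡2
... | u , v , w , d , u∈S , v∈S , w∉S , t≡Z = subst (_∈H K) t≡Z (S-ext u v w d u∈S v∈S w∉S)

Generated⊆ : ∀ {K : Family n} {X Y} → AllSmallIn 2 K → PairsExtend K X → PairsExtend K Y →
  ∀ Z → Z ∈H Generated X Y → Z ∈H K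
Generated⊆ {X = X} {Y} small X-ext Y-ext Z Z∈ with ∈Generated⁻ X Y Z Z∈
... | inj₁ ∣Z∣≤2 = small Z ∣Z∣≤2
... | inj₂ (∣Z∣≡3 , inj₁ ∣Z∩X∣≡2) = PairsExtend-split X-ext Z ∣Z∣≡3 ∣Z∩X∣≡2
... | inj₂ (∣Z∣≡3 , inj₂ ∣Z∩Y∣≡2) = PairsExtend-split Y-ext Z ∣Z∣≡3 ∣Z∩Y∣≡2

PairsExtend-edge : ∀ {H : Family n} {a b} → a ≢ b → (∀ z → Distinct a b z → triangle a b z ∈H H) →
  PairsExtend H (edge a b)
PairsExtend-edge {H = H} {a} {b} a≢b ext u v z (u≢v , _) u∈ v∈ z∉ =
  subst (λ e → (e ∪ ⁅ z ⁆) ∈H H) (sym edge≡)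
    (ext z (a≢b , (λ { refl → z∉ u∈edge }) , (λ { refl → z∉ v∈edge })))
  where
  edge≡ : edge u v ≡ edge a b
  edge≡ = p⊆q⇒∣q∣≤∣p∣⇒p≡q (edge⊆ u∈ v∈) (≤-reflexive (trans (∣edge∣≡2 a≢b) (sym (∣edge∣≡2 u≢v))))

-- Minimal complexes that go up

true⇔true⇒≡ : ∀ {a b : Bool} → (a ≡ true → b ≡ true) → (b ≡ true → a ≡ true) → a ≡ b
true⇔true⇒≡ {true} {true} _ _ = refl
true⇔true⇒≡ {true} {false} a⇒b _ = sym (a⇒b refl)
true⇔true⇒≡ {false} {true} _ b⇒a = b⇒a refl
true⇔true⇒≡ {false} {false} _ _ = refl

otherThan? : ∀ {P : Fin n → Set} → (∀ x → Dec (P x)) → ∀ a → (∃[ x ] (P x × x ≢ a)) ⊎ (∀ x → P x → x ≡ a)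
otherThan? P? a with any? (λ x → P? x ×-dec ¬? (x ≟ a))
... | yes witness = inj₁ witness
... | no none = inj₂ λ x Px → decidable-stable (x ≟ a) (λ x≢a → none (x , Px , x≢a))

otherThan₂? : ∀ {P : Fin n → Set} → (∀ x → Dec (P x)) → ∀ a b →
  (∃[ x ] (P x × x ≢ a × x ≢ b)) ⊎ (∀ x → P x → x ≡ a ⊎ x ≡ b)
otherThan₂? P? a b with any? (λ x → P? x ×-dec ¬? (x ≟ a) ×-dec ¬? (x ≟ b))
... | yes witness = inj₁ witness
... | no none = inj₂ onAB
  where
  onAB : ∀ x → _ → x ≡ a ⊎ x ≡ b
  onAB x Px with x ≟ a | x ≟ b
  ... | yes x≡a | _ = inj₁ x≡a
  ... | no _ | yes x≡b = inj₂ x≡b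
  ... | no x≢a | no x≢b = ⊥-elim (none (x , Px , x≢a , x≢b))

module _ {B C : Subset n} (L : Ladder B C) where
  open Ladder L

  Tight : Set
  Tight = (∀ x → x ∈ C × x ∉ B → x ≡ c) × (∀ x → x ∈ B → x ≡ b₁ ⊎ x ≡ b₂)

  Loose : Set
  Loose = (∃[ d ] ((d ∈ C × d ∉ B) × d ≢ c)) × (∃[ e ] (e ∉ C × e ≢ w))

record AdmissibleLadder (B C : Subset n) : Set where
  field
    ladder : Ladder B C
    shape : Tight ladder ⊎ Loose ladder

record Classification (H : Family n) : Set where
  field
    {B C} : Subset n
    H≗ : H ≗ Generated B C
    admissible : AdmissibleLadder B C

module Minimal {H : Family n} (m : mGU 2 n H) where

  small : AllSmallIn 2 H
  small = proj₂ (proj₂ (proj₁ (proj₁ m)))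

  -- Generated X Y ⊆ H always holds, and a proper inclusion would contradict minimality,
  -- since Generated X Y goes up.
  ⊆Generated : ∀ {X Y} → Ladder X Y → PairsExtend H X → PairsExtend H Y →
    ∀ Z → Z ∈H H → Z ∈H Generated X Y
  ⊆Generated {X} {Y} L X-ext Y-ext Z Z∈H with Generated X Y Z in Z∉
  ... | true = refl
  ... | false = ⊥-elim (proj₂ (proj₂ m (Generated X Y) isComplex Generated⊊H smallProperlyIn) goesUp)
    where
    open GeneratedByLadder {G = Generated X Y} (λ _ → refl) L using (isComplex; smallProperlyIn; goesUp)
    Generated⊊H : Generated X Y ⊊F H
    Generated⊊H = Generated⊆ small X-ext Y-ext , Z , Z∈H , λ Z∈ → case trans (sym Z∉) Z∈ of λ ()

  ≗Generated : ∀ {X Y} → Ladder X Y → PairsExtend H X → PairsExtend H Y → H ≗ Generated X Y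
  ≗Generated L X-ext Y-ext Z = true⇔true⇒≡ (⊆Generated L X-ext Y-ext Z) (Generated⊆ small X-ext Y-ext Z)

  module _ {B C : Subset n} (L : Ladder B C) (H≗ : H ≗ Generated B C) where
    open Ladder L
    open GeneratedByLadder H≗ L hiding (small)

    module _ (onlyGap : ∀ x → x ∈ C × x ∉ B → x ≡ c) {b₀} (b₀∈B : b₀ ∈ B) where

      edge-b₀c-extends : PairsExtend H (edge b₀ c)
      edge-b₀c-extends = PairsExtend-edge {H = H} (∈∧∉⇒≢ b₀∈B c∉B) λ z d →
        Generated⊆G (triangle b₀ c z) (b₀cz∈ z d)
        where
        b₀cz∈ : ∀ z → Distinct b₀ c z → triangle b₀ c z ∈H Generated B C
        b₀cz∈ z d with z ∈? B | z ∈? C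
        ... | yes z∈B | _ = triangle∈Generated d (innerZone b₀∈B) (gap c∉B c∈C) (innerZone z∈B)
        ... | no z∉B | no z∉C = triangle∈Generated d (innerZone b₀∈B) (gap c∉B c∈C) (outer z∉B z∉C)
        ... | no z∉B | yes z∈C = ⊥-elim (proj₂ (proj₂ d) (sym (onlyGap z (z∈C , z∉B))))

    -- Otherwise {b₀, c} ⊂ C is a ladder in T(H) whose complex misses the face {b₁, b₂, c}.
    noThirdInner : (∀ x → x ∈ C × x ∉ B → x ≡ c) → ¬ (∃[ b₀ ] (b₀ ∈ B × b₀ ≢ b₁ × b₀ ≢ b₂))
    noThirdInner onlyGap (b₀ , b₀∈B , b₀≢b₁ , b₀≢b₂) =
      triangle∉Generated distinct-b₁b₂c (gap b₁∉X (B⊆C b₁∈B)) (gap b₂∉X (B⊆C b₂∈B)) (inner v∈edge c∈C)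
        (⊆Generated L′ (edge-b₀c-extends onlyGap b₀∈B) C-extends (triangle b₁ b₂ c)
          (B-extends b₁ b₂ c distinct-b₁b₂c b₁∈B b₂∈B c∉B))
      where
      X = edge b₀ c
      b₁∉X = ∉edge (b₀≢b₁ ∘ sym) (∈∧∉⇒≢ b₁∈B c∉B)
      b₂∉X = ∉edge (b₀≢b₂ ∘ sym) (∈∧∉⇒≢ b₂∈B c∉B)
      L′ : Ladder X C
      L′ = record { B⊆C = edge⊆ (B⊆C b₀∈B) c∈C ; b₁ = b₀ ; b₂ = c ; c = b₁ ; w = w
                  ; b₁∈B = u∈edge ; b₂∈B = v∈edge ; b₁≢b₂ = ∈∧∉⇒≢ b₀∈B c∉B
                  ; c∈C = B⊆C b₁∈B ; c∉B = b₁∉X ; w∉C = w∉C }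

    module _ (onlyW : ∀ x → x ∉ C → x ≡ w) where

      private
        b₁≢w = ∈∧∉⇒≢ b₁∈B w∉B
        ∈C : ∀ {x} → x ≢ w → x ∈ C
        ∈C {x} x≢w = decidable-stable (x ∈? C) (x≢w ∘ onlyW x)

      edge-b₁w-extends : PairsExtend H (edge b₁ w)
      edge-b₁w-extends = PairsExtend-edge {H = H} b₁≢w λ z d →
        Generated⊆G (triangle b₁ w z) (b₁wz∈ z d)
        where
        b₁wz∈ : ∀ z → Distinct b₁ w z → triangle b₁ w z ∈H Generated B C
        b₁wz∈ z d@(_ , _ , w≢z) with zoneOf B⊆C z
        ... | inner , at-z = triangle∈Generated d (innerZone b₁∈B) (outerZone w∉C) at-z
        ... | gap , at-z = triangle∈Generated d (innerZone b₁∈B) (outerZone w∉C) at-z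
        ... | outer , outer _ z∉C = ⊥-elim (w≢z (sym (onlyW z z∉C)))

      B∪w-extends : PairsExtend H (B ∪ ⁅ w ⁆)
      B∪w-extends u v z d@(u≢v , _ , _) u∈ v∈ z∉ =
        Generated⊆G (triangle u v z) (uvz∈ (x∈p∪q⁻ B ⁅ w ⁆ u∈) (x∈p∪q⁻ B ⁅ w ⁆ v∈))
        where
        z-gap : ZoneOf B C z gap
        z-gap = gap (z∉ ∘ p⊆p∪q ⁅ w ⁆) (∈C λ { refl → z∉ (q⊆p∪q B ⁅ w ⁆ (x∈⁅x⁆ w)) })
        uvz∈ : u ∈ B ⊎ u ∈ ⁅ w ⁆ → v ∈ B ⊎ v ∈ ⁅ w ⁆ → triangle u v z ∈H Generated B C
        uvz∈ (inj₁ u∈B) (inj₁ v∈B) = triangle∈Generated d (innerZone u∈B) (innerZone v∈B) z-gap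
        uvz∈ (inj₁ u∈B) (inj₂ v∈⁅w⁆) with x∈⁅y⁆⇒x≡y w v∈⁅w⁆
        ... | refl = triangle∈Generated d (innerZone u∈B) (outerZone w∉C) z-gap
        uvz∈ (inj₂ u∈⁅w⁆) (inj₁ v∈B) with x∈⁅y⁆⇒x≡y w u∈⁅w⁆
        ... | refl = triangle∈Generated d (outerZone w∉C) (innerZone v∈B) z-gap
        uvz∈ (inj₂ u∈⁅w⁆) (inj₂ v∈⁅w⁆) =
          ⊥-elim (u≢v (trans (x∈⁅y⁆⇒x≡y w u∈⁅w⁆) (sym (x∈⁅y⁆⇒x≡y w v∈⁅w⁆))))

      -- Otherwise {b₁, w} ⊂ B ∪ {w} is a ladder in T(H) whose complex misses the face {c, d, w}.
      noSecondGap : ¬ (∃[ d ] ((d ∈ C × d ∉ B) × d ≢ c))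
      noSecondGap (d , (d∈C , d∉B) , d≢c) =
        triangle∉Generated cdw (outer (c∉Y ∘ X⊆Y) c∉Y) (outer (d∉Y ∘ X⊆Y) d∉Y) (inner v∈edge w∈Y)
          (⊆Generated L′ edge-b₁w-extends B∪w-extends (triangle c d w) (C-extends c d w cdw c∈C d∈C w∉C))
        where
        X = edge b₁ w
        Y = B ∪ ⁅ w ⁆
        w∈Y = q⊆p∪q B ⁅ w ⁆ (x∈⁅x⁆ w)
        X⊆Y = edge⊆ (p⊆p∪q ⁅ w ⁆ b₁∈B) w∈Y
        ∉Y : ∀ {x} → x ∉ B → x ≢ w → x ∉ Y
        ∉Y x∉B x≢w x∈Y = [ x∉B , x≢w ∘ x∈⁅y⁆⇒x≡y w ] (x∈p∪q⁻ B ⁅ w ⁆ x∈Y)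
        d≢w = ∈∧∉⇒≢ d∈C w∉C
        cdw : Distinct c d w
        cdw = d≢c ∘ sym , c≢w , d≢w
        c∉Y = ∉Y c∉B c≢w
        d∉Y = ∉Y d∉B d≢w
        L′ : Ladder X Y
        L′ = record { B⊆C = X⊆Y ; b₁ = b₁ ; b₂ = w ; c = b₂ ; w = c
                    ; b₁∈B = u∈edge ; b₂∈B = v∈edge ; b₁≢b₂ = b₁≢w ; c∈C = p⊆p∪q ⁅ w ⁆ b₂∈B
                    ; c∉B = ∉edge (b₁≢b₂ ∘ sym) (∈∧∉⇒≢ b₂∈B w∉B) ; w∉C = c∉Y }

classify : ∀ {H : Family n} → mGU 2 n H → Classification H
classify {H = H} m = record { H≗ = H≗ ; admissible = record { ladder = ladder ; shape = shape } }
  where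
  open Minimal m
  open LadderIn (ladderOfGoesUp small (proj₂ (proj₁ m)))
  open Ladder ladder
  H≗ : H ≗ Generated B C
  H≗ = ≗Generated ladder B-extends C-extends
  shape : Tight ladder ⊎ Loose ladder
  shape with otherThan? (λ x → x ∈? C ×-dec ¬? (x ∈? B)) c
  ... | inj₁ secondGap with otherThan? (λ x → ¬? (x ∈? C)) w
  ...   | inj₁ secondOuter = inj₂ (secondGap , secondOuter)
  ...   | inj₂ onlyW = ⊥-elim (noSecondGap ladder H≗ onlyW secondGap)
  shape | inj₂ onlyGap with otherThan₂? (_∈? B) b₁ b₂
  ... | inj₁ thirdInner = ⊥-elim (noThirdInner ladder H≗ onlyGap thirdInner)
  ... | inj₂ onlyB = inj₁ (onlyGap , onlyB)

-- Admissible ladders generate minimal complexes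

oneAvoids : ∀ {P : Fin n → Set} {a b} → P a → P b → a ≢ b → ∀ x → ∃[ y ] (P y × y ≢ x)
oneAvoids {a = a} {b} Pa Pb a≢b x with a ≟ x
... | yes refl = b , Pb , a≢b ∘ sym
... | no a≢x = a , Pa , a≢x

module SetsInT {G : Family n} {B C : Subset n} (G≗ : G ≗ Generated B C) (L : Ladder B C) where
  open Ladder L
  open GeneratedByLadder G≗ L

  excluded : ∀ {S x y z zx zy zz} → x ∈ S → y ∈ S → x ≢ y → z ∉ S →
    ZoneOf B C x zx → ZoneOf B C y zy → ZoneOf B C z zz →
    {_ : False (#B zx zy zz ≟ℕ 2)} {_ : False (#C zx zy zz ≟ℕ 2)} → ¬ PairsExtend G S
  excluded {x = x} {y} {z} x∈S y∈S x≢y z∉S at-x at-y at-z {≢B} {≢C} S-ext =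
    triangle∉Generated d at-x at-y at-z {≢B} {≢C}
      (G⊆Generated (triangle x y z) (S-ext x y z d x∈S y∈S z∉S))
    where
    d = x≢y , ∈∧∉⇒≢ x∈S z∉S , ∈∧∉⇒≢ y∈S z∉S

  noTwoOutside : ∀ {S t x y} → t ∉ S → x ∈ S → y ∈ S → x ≢ y → x ∉ C → y ∉ C → ¬ PairsExtend G S
  noTwoOutside {t = t} t∉S x∈S y∈S x≢y x∉C y∉C =
    let zt , at-t = zoneOf B⊆C t
    in excluded x∈S y∈S x≢y t∉S (outerZone x∉C) (outerZone y∉C) at-t
         {fromWitnessFalse (𝟙≢2 (inB zt))} {fromWitnessFalse (𝟙≢2 (inC zt))}

  module _ {S s₁ s₂} (S-ext : PairsExtend G S) (s₁∈S : s₁ ∈ S) (s₂∈S : s₂ ∈ S) (s₁≢s₂ : s₁ ≢ s₂) where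

    -- A point x ∈ S ∖ C, a second point of S and a point outside S ∪ C would span a triangle
    -- meeting B and C at most once.
    ⊆C : ∀ {t} → t ∉ S → (∃[ e ] (e ∉ C × e ≢ w)) → S ⊆ C
    ⊆C t∉S (e , e∉C , e≢w) {x} x∈S = decidable-stable (x ∈? C) λ x∉C →
      let u , u∈S , u≢x = oneAvoids s₁∈S s₂∈S s₁≢s₂ x
          e′ , e′∉C , e′≢x = oneAvoids {P = _∉ C} e∉C w∉C e≢w x
          e′∉S = λ e′∈S → noTwoOutside t∉S x∈S e′∈S (e′≢x ∘ sym) x∉C e′∉C S-ext
      in spoilt x∉C u∈S (u≢x ∘ sym) e′∉C e′∉S (proj₂ (zoneOf B⊆C u))
      where
      spoilt : ∀ {u e′ z} → x ∉ C → u ∈ S → x ≢ u → e′ ∉ C → e′ ∉ S → ¬ ZoneOf B C u z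
      spoilt x∉C u∈S x≢u e′∉C e′∉S at-u@(inner _ _) =
        excluded x∈S u∈S x≢u e′∉S (outerZone x∉C) at-u (outerZone e′∉C) S-ext
      spoilt x∉C u∈S x≢u e′∉C e′∉S at-u@(gap _ _) =
        excluded x∈S u∈S x≢u e′∉S (outerZone x∉C) at-u (outerZone e′∉C) S-ext
      spoilt x∉C u∈S x≢u _ _ (outer _ u∉C) = noTwoOutside t∉S x∈S u∈S x≢u x∉C u∉C S-ext

    B⊆ : S ⊆ C → (∃[ d ] ((d ∈ C × d ∉ B) × d ≢ c)) → B ⊆ S
    B⊆ S⊆C (d , (d∈C , d∉B) , d≢c) {b} b∈B = decidable-stable (b ∈? S) b∉S⇒⊥
      where
      -- A triangle of S with one vertex in B and one in C ∖ B is spoilt by c or d, or else {d, c, b} is.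
      mixed : ∀ {x y} → b ∉ S → x ∈ S → y ∈ S → x ≢ y → ZoneOf B C x inner → ¬ ZoneOf B C y gap
      mixed b∉S x∈S y∈S x≢y at-x at-y with c ∈? S | d ∈? S
      ... | no c∉S | _ = excluded x∈S y∈S x≢y c∉S at-x at-y (gap c∉B c∈C) S-ext
      ... | yes _ | no d∉S = excluded x∈S y∈S x≢y d∉S at-x at-y (gap d∉B d∈C) S-ext
      ... | yes c∈S | yes d∈S =
        excluded d∈S c∈S d≢c b∉S (gap d∉B d∈C) (gap c∉B c∈C) (innerZone b∈B) S-ext
      b∉S⇒⊥ : ¬ b ∉ S
      b∉S⇒⊥ b∉S with zoneOf B⊆C s₁ | zoneOf B⊆C s₂
      ... | inner , at₁ | inner , at₂ = excluded s₁∈S s₂∈S s₁≢s₂ b∉S at₁ at₂ (innerZone b∈B) S-ext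
      ... | gap , at₁ | gap , at₂ = excluded s₁∈S s₂∈S s₁≢s₂ b∉S at₁ at₂ (innerZone b∈B) S-ext
      ... | inner , at₁ | gap , at₂ = mixed b∉S s₁∈S s₂∈S s₁≢s₂ at₁ at₂
      ... | gap , at₁ | inner , at₂ = mixed b∉S s₂∈S s₁∈S (s₁≢s₂ ∘ sym) at₂ at₁
      ... | outer , outer _ s₁∉C | _ = s₁∉C (S⊆C s₁∈S)
      ... | _ | outer , outer _ s₂∉C = s₂∉C (S⊆C s₂∈S)

  between⇒≡B⊎≡C : ∀ {S} → PairsExtend G S → B ⊆ S → S ⊆ C → S ≡ B ⊎ S ≡ C
  between⇒≡B⊎≡C {S} S-ext B⊆S S⊆C with any? (λ y → y ∈? S ×-dec ¬? (y ∈? B))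
  ... | no none =
    inj₁ (⊆-antisym (λ {x} x∈S → decidable-stable (x ∈? B) (λ x∉B → none (x , x∈S , x∉B))) B⊆S)
  ... | yes (y , y∈S , y∉B) = inj₂ (⊆-antisym S⊆C C⊆S)
    where
    C⊆S : C ⊆ S
    C⊆S {z} z∈C = decidable-stable (z ∈? S) λ z∉S →
      excluded (B⊆S b₁∈B) y∈S (∈∧∉⇒≢ b₁∈B y∉B) z∉S
        (innerZone b₁∈B) (gap y∉B (S⊆C y∈S)) (gap (z∉S ∘ B⊆S) z∈C) S-ext

  Loose⇒≡B⊎≡C : Loose L → ∀ {S s₁ s₂ t} → PairsExtend G S →
    s₁ ∈ S → s₂ ∈ S → s₁ ≢ s₂ → t ∉ S → S ≡ B ⊎ S ≡ C
  Loose⇒≡B⊎≡C (secondGap , secondOuter) S-ext s₁∈S s₂∈S s₁≢s₂ t∉S =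
    between⇒≡B⊎≡C S-ext (B⊆ S-ext s₁∈S s₂∈S s₁≢s₂ S⊆C secondGap) S⊆C
    where
    S⊆C = ⊆C S-ext s₁∈S s₂∈S s₁≢s₂ t∉S secondOuter

module _ {B C : Subset n} (L : Ladder B C) where
  open Ladder L

  Tight⇒⊆b₁b₂cw : Tight L → (∀ x → x ∉ C → x ≡ w) → ∀ x → x ∈ triangle b₁ b₂ c ∪ ⁅ w ⁆
  Tight⇒⊆b₁b₂cw (onlyGap , onlyB) onlyW x with x ∈? C | x ∈? B
  ... | no x∉C | _ = x∈p∪q⁺ (inj₂ (subst (_∈ ⁅ w ⁆) (sym (onlyW x x∉C)) (x∈⁅x⁆ w)))
  ... | yes x∈C | no x∉B =
    x∈p∪q⁺ (inj₁ (subst (_∈ triangle b₁ b₂ c) (sym (onlyGap x (x∈C , x∉B))) w∈triangle))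
  ... | yes _ | yes x∈B with onlyB x x∈B
  ...   | inj₁ refl = x∈p∪q⁺ (inj₁ u∈triangle)
  ...   | inj₂ refl = x∈p∪q⁺ (inj₁ v∈triangle)

  Tight⇒n≤4 : Tight L → (∀ x → x ∉ C → x ≡ w) → n ≤ 4
  Tight⇒n≤4 tight onlyW = begin
    n                             ≡⟨ ∣⊤∣≡n n ⟨
    ∣ ⊤ {n} ∣                      ≤⟨ p⊆q⇒∣p∣≤∣q∣ {p = ⊤} (λ {x} _ → Tight⇒⊆b₁b₂cw tight onlyW x) ⟩
    ∣ triangle b₁ b₂ c ∪ ⁅ w ⁆ ∣    ≤⟨ ∣p∪q∣≤∣p∣+∣q∣ (triangle b₁ b₂ c) ⁅ w ⁆ ⟩
    ∣ triangle b₁ b₂ c ∣ + ∣ ⁅ w ⁆ ∣  ≤⟨ +-mono-≤ (∣triangle∣≤3 b₁ b₂ c) (≤-reflexive (∣⁅x⁆∣≡1 w)) ⟩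
    4                             ∎
    where open ≤-Reasoning

module Cover {G : Family n} {B C : Subset n} (G≗ : G ≗ Generated B C) (L : Ladder B C)
  {K : Family n} (K⊆G : ∀ Z → Z ∈H K → Z ∈H G) (K-small : AllSmallIn 2 K) (P : LadderIn K) where
  open Ladder L
  open GeneratedByLadder G≗ L using (G⊆Generated)
  open SetsInT G≗ L
  open LadderIn P renaming (B to X; C to Y; B-extends to X-ext; C-extends to Y-ext)
  module P = Ladder ladder

  X-extG : PairsExtend G X
  X-extG = PairsExtend-⊆ K⊆G X-ext

  Y-extG : PairsExtend G Y
  Y-extG = PairsExtend-⊆ K⊆G Y-ext

  t : Subset n
  t = triangle P.b₁ P.b₂ P.c

  t⊆Y : t ⊆ Y
  t⊆Y = triangle⊆ (P.B⊆C P.b₁∈B) (P.B⊆C P.b₂∈B) P.c∈C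

  t∈K : t ∈H K
  t∈K = X-ext P.b₁ P.b₂ P.c P.distinct-b₁b₂c P.b₁∈B P.b₂∈B P.c∉B

  ∣t∣≡3 : ∣ t ∣ ≡ 3
  ∣t∣≡3 = ∣triangle∣≡3 P.distinct-b₁b₂c

  -- Here X and Y must be B and C in some order.
  G⊆K-loose : Loose L → ∀ Z → Z ∈H G → Z ∈H K
  G⊆K-loose loose Z Z∈G =
    cover (Loose⇒≡B⊎≡C loose X-extG P.b₁∈B P.b₂∈B P.b₁≢b₂ P.w∉B)
          (Loose⇒≡B⊎≡C loose Y-extG (P.B⊆C P.b₁∈B) (P.B⊆C P.b₂∈B) P.b₁≢b₂ P.w∉C)
    where
    fromExt : PairsExtend K B → PairsExtend K C → Z ∈H K
    fromExt B-ext C-ext = Generated⊆ K-small B-ext C-ext Z (G⊆Generated Z Z∈G)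
    X≢Y : X ≢ Y
    X≢Y X≡Y = P.c∉B (subst (P.c ∈_) (sym X≡Y) P.c∈C)
    cover : X ≡ B ⊎ X ≡ C → Y ≡ B ⊎ Y ≡ C → Z ∈H K
    cover (inj₁ X≡B) (inj₂ Y≡C) =
      fromExt (subst (PairsExtend K) X≡B X-ext) (subst (PairsExtend K) Y≡C Y-ext)
    cover (inj₂ X≡C) (inj₁ Y≡B) =
      fromExt (subst (PairsExtend K) Y≡B Y-ext) (subst (PairsExtend K) X≡C X-ext)
    cover (inj₁ X≡B) (inj₁ Y≡B) = ⊥-elim (X≢Y (trans X≡B (sym Y≡B)))
    cover (inj₂ X≡C) (inj₂ Y≡C) = ⊥-elim (X≢Y (trans X≡C (sym Y≡C)))

  -- Here Y = C = {b₁, b₂, c}, so C ∈ T(K) and C ∈ K, and every face of G is covered by one of the two.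
  G⊆K-tight : Tight L → (∃[ e ] (e ∉ C × e ≢ w)) → ∀ Z → Z ∈H G → Z ∈H K
  G⊆K-tight (onlyGap , onlyB) secondOuter Z Z∈G = cover (∈Generated⁻ B C Z (G⊆Generated Z Z∈G))
    where
    Y⊆C : Y ⊆ C
    Y⊆C = ⊆C Y-extG (P.B⊆C P.b₁∈B) (P.B⊆C P.b₂∈B) P.b₁≢b₂ P.w∉C secondOuter
    C⊆b₁b₂c : C ⊆ triangle b₁ b₂ c
    C⊆b₁b₂c {x} x∈C with x ∈? B
    ... | no x∉B = subst (_∈ triangle b₁ b₂ c) (sym (onlyGap x (x∈C , x∉B))) w∈triangle
    ... | yes x∈B with onlyB x x∈B
    ...   | inj₁ refl = u∈triangle
    ...   | inj₂ refl = v∈triangle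
    ∣C∣≤3 : ∣ C ∣ ≤ 3
    ∣C∣≤3 = ≤-trans (p⊆q⇒∣p∣≤∣q∣ C⊆b₁b₂c) (∣triangle∣≤3 b₁ b₂ c)
    ≡C : ∀ {S} → S ⊆ C → ∣ S ∣ ≡ 3 → S ≡ C
    ≡C S⊆C ∣S∣≡3 = p⊆q⇒∣q∣≤∣p∣⇒p≡q S⊆C (≤-trans ∣C∣≤3 (≤-reflexive (sym ∣S∣≡3)))
    t≡C : t ≡ C
    t≡C = ≡C (Y⊆C ∘ t⊆Y) ∣t∣≡3
    C-extK : PairsExtend K C
    C-extK u v z d u∈C v∈C z∉C = Y-ext u v z d (C⊆Y u∈C) (C⊆Y v∈C) (z∉C ∘ Y⊆C)
      where
      C⊆Y : C ⊆ Y
      C⊆Y = t⊆Y ∘ subst (_ ∈_) (sym t≡C)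
    cover : GeneratedFace B C Z → Z ∈H K
    cover (inj₁ ∣Z∣≤2) = K-small Z ∣Z∣≤2
    cover (inj₂ (∣Z∣≡3 , inj₂ ∣Z∩C∣≡2)) = PairsExtend-split C-extK Z ∣Z∣≡3 ∣Z∩C∣≡2
    cover (inj₂ (∣Z∣≡3 , inj₁ ∣Z∩B∣≡2)) with splitTriangle ∣Z∣≡3 ∣Z∩B∣≡2
    ... | u , v , z , d , u∈B , v∈B , z∉B , uvz≡Z with z ∈? C
    ...   | no z∉C = subst (_∈H K) uvz≡Z (C-extK u v z d (B⊆C u∈B) (B⊆C v∈B) z∉C)
    ...   | yes z∈C = subst (_∈H K) (trans t≡C (sym Z≡C)) t∈K
      where
      Z≡C : Z ≡ C
      Z≡C = ≡C (subst (_⊆ C) uvz≡Z (triangle⊆ (B⊆C u∈B) (B⊆C v∈B) z∈C)) ∣Z∣≡3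

  -- Here V = {p₁, p₂, c′, w′} for the vertices of the ladder in K, so K contains every 3-set:
  -- those avoiding w′ equal {p₁, p₂, c′} ∈ K, the others meet Y in two points.
  G⊆K-fourVertices : Tight L → (∀ x → x ∉ C → x ≡ w) → ∀ Z → Z ∈H G → Z ∈H K
  G⊆K-fourVertices tight onlyW Z Z∈G = cover (∈Generated⁻ B C Z (G⊆Generated Z Z∈G))
    where
    w′∉t : P.w ∉ t
    w′∉t = P.w∉C ∘ t⊆Y
    Q≡⊤ : t ∪ ⁅ P.w ⁆ ≡ ⊤
    Q≡⊤ = p⊆q⇒∣q∣≤∣p∣⇒p≡q ⊆⊤ (begin
      ∣ ⊤ {n} ∣           ≡⟨ ∣⊤∣≡n n ⟩
      n                  ≤⟨ Tight⇒n≤4 L tight onlyW ⟩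
      4                  ≡⟨ cong suc ∣t∣≡3 ⟨
      suc ∣ t ∣           ≡⟨ ∣p∪⁅x⁆∣≡1+∣p∣ t w′∉t ⟨
      ∣ t ∪ ⁅ P.w ⁆ ∣      ∎)
      where open ≤-Reasoning
    ∈t⊎≡w′ : ∀ x → x ∈ t ⊎ x ∈ ⁅ P.w ⁆
    ∈t⊎≡w′ x = x∈p∪q⁻ t ⁅ P.w ⁆ (subst (x ∈_) (sym Q≡⊤) ∈⊤)
    cover : GeneratedFace B C Z → Z ∈H K
    cover (inj₁ ∣Z∣≤2) = K-small Z ∣Z∣≤2
    cover (inj₂ (∣Z∣≡3 , _)) with P.w ∈? Z
    ... | no w′∉Z = subst (_∈H K) t≡Z t∈K
      where
      Z⊆t : Z ⊆ t
      Z⊆t {x} x∈Z =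
        [ id , (λ x∈⁅w′⁆ → ⊥-elim (w′∉Z (subst (_∈ Z) (x∈⁅y⁆⇒x≡y P.w x∈⁅w′⁆) x∈Z))) ] (∈t⊎≡w′ x)
      t≡Z : t ≡ Z
      t≡Z = sym (p⊆q⇒∣q∣≤∣p∣⇒p≡q Z⊆t (≤-reflexive (trans ∣t∣≡3 (sym ∣Z∣≡3))))
    ... | yes w′∈Z = PairsExtend-split Y-ext Z ∣Z∣≡3 (+-cancelʳ-≡ 1 _ 2 (begin
      ∣ Z ∩ Y ∣ + 1             ≡⟨ cong (∣ Z ∩ Y ∣ +_) (trans (cong ∣_∣ Z∖Y≡w′) (∣⁅x⁆∣≡1 P.w)) ⟨
      ∣ Z ∩ Y ∣ + ∣ Z ∩ ∁ Y ∣     ≡⟨ ∣p∣≡∣p∩q∣+∣p∩∁q∣ Z Y ⟨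
      ∣ Z ∣                     ≡⟨ ∣Z∣≡3 ⟩
      3                         ∎))
      where
      open ≡-Reasoning
      Z∖Y≡w′ : Z ∩ ∁ Y ≡ ⁅ P.w ⁆
      Z∖Y≡w′ = ⊆-antisym ⊆w′ w′⊆
        where
        ⊆w′ : Z ∩ ∁ Y ⊆ ⁅ P.w ⁆
        ⊆w′ {x} x∈ =
          [ (λ x∈t → ⊥-elim (x∈∁p⇒x∉p (proj₂ (x∈p∩q⁻ Z (∁ Y) x∈)) (t⊆Y x∈t))) , id ] (∈t⊎≡w′ x)
        w′⊆ : ⁅ P.w ⁆ ⊆ Z ∩ ∁ Y
        w′⊆ x∈⁅w′⁆ rewrite x∈⁅y⁆⇒x≡y P.w x∈⁅w′⁆ = x∈p∩q⁺ (w′∈Z , x∉p⇒x∈∁p P.w∉C)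

  G⊆K : Tight L ⊎ Loose L → ∀ Z → Z ∈H G → Z ∈H K
  G⊆K (inj₂ loose) = G⊆K-loose loose
  G⊆K (inj₁ tight) with otherThan? (λ x → ¬? (x ∈? C)) w
  ... | inj₁ secondOuter = G⊆K-tight tight secondOuter
  ... | inj₂ onlyW = G⊆K-fourVertices tight onlyW

Admissible⇒mGU : ∀ {G : Family n} {B C} → G ≗ Generated B C → AdmissibleLadder B C → mGU 2 n G
Admissible⇒mGU {n} {G} G≗ A = (pav , goesUp) , minimal
  where
  open AdmissibleLadder A
  open GeneratedByLadder G≗ ladder
  minimal : ∀ K → IsComplex n K → K ⊊F G → SmallProperlyIn 2 K → NGU 2 n K
  minimal K K-complex (K⊆G , Z , Z∈G , Z∉K) (K-small , X , X∈K , ∣X∣≰2) =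
    (K-complex , K-dim , K-small) ,
    λ K-up → Z∉K (Cover.G⊆K G≗ ladder K⊆G K-small (ladderOfGoesUp K-small K-up) shape Z Z∈G)
    where
    K-dim : HasDim 2 K
    K-dim = (X , X∈K , ≤-antisym (bound X (K⊆G X X∈K)) (≰⇒> ∣X∣≰2)) , λ Y Y∈K → bound Y (K⊆G Y Y∈K)

-- Deleting a vertex

lookup-removeAt : ∀ (S : Subset (suc n)) p v → lookup (removeAt S p) v ≡ lookup S (punchIn p v)
lookup-removeAt (_ ∷ _) zero v = refl
lookup-removeAt {suc n} (_ ∷ _ ∷ _) (suc p) zero = refl
lookup-removeAt {suc n} (_ ∷ S@(_ ∷ _)) (suc p) (suc v) = lookup-removeAt S p v

∣insertAt-outside∣ : ∀ (Z : Subset n) p → ∣ insertAt Z p outside ∣ ≡ ∣ Z ∣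
∣insertAt-outside∣ Z zero = refl
∣insertAt-outside∣ (true ∷ Z) (suc p) = cong suc (∣insertAt-outside∣ Z p)
∣insertAt-outside∣ (false ∷ Z) (suc p) = ∣insertAt-outside∣ Z p

insertAt-outside-∩ : ∀ (Z : Subset n) p S →
  insertAt Z p outside ∩ S ≡ insertAt (Z ∩ removeAt S p) p outside
insertAt-outside-∩ Z zero (_ ∷ _) = refl
insertAt-outside-∩ (z ∷ Z) (suc p) (s ∷ S@(_ ∷ _)) = cong (z ∧ s ∷_) (insertAt-outside-∩ Z p S)

Generated-insertAt : ∀ (B C : Subset (suc n)) p Z →
  Generated B C (insertAt Z p outside) ≡ Generated (removeAt B p) (removeAt C p) Z
Generated-insertAt B C p Z
  rewrite insertAt-outside-∩ Z p B | insertAt-outside-∩ Z p C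
        | ∣insertAt-outside∣ Z p
        | ∣insertAt-outside∣ (Z ∩ removeAt B p) p | ∣insertAt-outside∣ (Z ∩ removeAt C p) p
  = refl

module _ {S : Subset (suc n)} {p : Fin (suc n)} where

  ∈removeAt⇔ : ∀ {v} → v ∈ removeAt S p ⇔ punchIn p v ∈ S
  ∈removeAt⇔ {v} = mk⇔
    (λ v∈ → lookup⇒[]= _ S (trans (sym (lookup-removeAt S p v)) ([]=⇒lookup v∈)))
    (λ pv∈ → lookup⇒[]= v _ (trans (lookup-removeAt S p v) ([]=⇒lookup pv∈)))

  punchOut∈removeAt : ∀ {x} (p≢x : p ≢ x) → x ∈ S → punchOut p≢x ∈ removeAt S p
  punchOut∈removeAt p≢x x∈S = Equivalence.from ∈removeAt⇔ (subst (_∈ S) (sym (punchIn-punchOut p≢x)) x∈S)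

  punchOut∉removeAt : ∀ {x} (p≢x : p ≢ x) → x ∉ S → punchOut p≢x ∉ removeAt S p
  punchOut∉removeAt p≢x x∉S = x∉S ∘ subst (_∈ S) (punchIn-punchOut p≢x) ∘ Equivalence.to ∈removeAt⇔

punchIn≡⇒≡punchOut : ∀ {p x : Fin (suc n)} {v} (p≢x : p ≢ x) → punchIn p v ≡ x → v ≡ punchOut p≢x
punchIn≡⇒≡punchOut {p = p} {v = v} p≢x pv≡x =
  punchIn-injective p v _ (trans pv≡x (sym (punchIn-punchOut p≢x)))

module Removal {B C : Subset (suc n)} (L : Ladder B C) {p : Fin (suc n)} where
  open Ladder L

  module _ (p≢b₁ : p ≢ b₁) (p≢b₂ : p ≢ b₂) (p≢c : p ≢ c) (p≢w : p ≢ w) where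

    ladder′ : Ladder (removeAt B p) (removeAt C p)
    ladder′ = record
      { B⊆C = Equivalence.from ∈removeAt⇔ ∘ B⊆C ∘ Equivalence.to ∈removeAt⇔
      ; b₁ = punchOut p≢b₁ ; b₂ = punchOut p≢b₂ ; c = punchOut p≢c ; w = punchOut p≢w
      ; b₁∈B = punchOut∈removeAt p≢b₁ b₁∈B
      ; b₂∈B = punchOut∈removeAt p≢b₂ b₂∈B
      ; b₁≢b₂ = b₁≢b₂ ∘ punchOut-injective p≢b₁ p≢b₂
      ; c∈C = punchOut∈removeAt p≢c c∈C
      ; c∉B = punchOut∉removeAt p≢c c∉B
      ; w∉C = punchOut∉removeAt p≢w w∉C
      }

    removeAt-Tight : (∀ x → p ≢ x → x ∈ C × x ∉ B → x ≡ c) →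
      (∀ x → p ≢ x → x ∈ B → x ≡ b₁ ⊎ x ≡ b₂) → AdmissibleLadder (removeAt B p) (removeAt C p)
    removeAt-Tight onlyGap onlyB = record { ladder = ladder′ ; shape = inj₁ (onlyGap′ , onlyB′) }
      where
      p≢pv : ∀ {v} → p ≢ punchIn p v
      p≢pv {v} = punchInᵢ≢i p v ∘ sym
      onlyGap′ : ∀ v → v ∈ removeAt C p × v ∉ removeAt B p → v ≡ punchOut p≢c
      onlyGap′ v (v∈C , v∉B) = punchIn≡⇒≡punchOut p≢c
        (onlyGap (punchIn p v) p≢pv (Equivalence.to ∈removeAt⇔ v∈C , v∉B ∘ Equivalence.from ∈removeAt⇔))
      onlyB′ : ∀ v → v ∈ removeAt B p → v ≡ punchOut p≢b₁ ⊎ v ≡ punchOut p≢b₂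
      onlyB′ v v∈B = Data.Sum.map (punchIn≡⇒≡punchOut p≢b₁) (punchIn≡⇒≡punchOut p≢b₂)
        (onlyB (punchIn p v) p≢pv (Equivalence.to ∈removeAt⇔ v∈B))

    removeAt-Loose : ∀ {d e} (p≢d : p ≢ d) (p≢e : p ≢ e) →
      d ∈ C × d ∉ B → d ≢ c → e ∉ C → e ≢ w → AdmissibleLadder (removeAt B p) (removeAt C p)
    removeAt-Loose p≢d p≢e (d∈C , d∉B) d≢c e∉C e≢w = record { ladder = ladder′ ; shape = inj₂ (
      (punchOut p≢d , (punchOut∈removeAt p≢d d∈C , punchOut∉removeAt p≢d d∉B) ,
        d≢c ∘ punchOut-injective p≢d p≢c) ,
      (punchOut p≢e , punchOut∉removeAt p≢e e∉C , e≢w ∘ punchOut-injective p≢e p≢w)) }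

module _ {B C : Subset (suc n)} (L : Ladder B C) where
  open Ladder L
  open Removal L

  -- A vertex outside the ladder is removable if it is a surplus point of V ∖ C (tight case), or of
  -- C ∖ B or B (loose case); if there is none of the latter, removing d leaves a tight ladder.
  removable : 4 < suc n → Tight L ⊎ Loose L → ∃[ p ] AdmissibleLadder (removeAt B p) (removeAt C p)
  removable 4<n+1 (inj₁ tight@(onlyGap , onlyB)) with otherThan? (λ x → ¬? (x ∈? C)) w
  ... | inj₂ onlyW = ⊥-elim (<-irrefl refl (≤-trans 4<n+1 (Tight⇒n≤4 L tight onlyW)))
  ... | inj₁ (e , e∉C , e≢w) =
    e , removeAt-Tight (≢-sym (∈∧∉⇒≢ (B⊆C b₁∈B) e∉C)) (≢-sym (∈∧∉⇒≢ (B⊆C b₂∈B) e∉C))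
          (≢-sym (∈∧∉⇒≢ c∈C e∉C)) e≢w (λ x _ → onlyGap x) (λ x _ → onlyB x)
  removable 4<n+1 (inj₂ ((d , d∈C∖B@(d∈C , d∉B) , d≢c) , (e , e∉C , e≢w)))
    with otherThan₂? (λ x → x ∈? C ×-dec ¬? (x ∈? B)) c d
  ... | inj₁ (g , (g∈C , g∉B) , g≢c , g≢d) =
    g , removeAt-Loose (≢-sym (∈∧∉⇒≢ b₁∈B g∉B)) (≢-sym (∈∧∉⇒≢ b₂∈B g∉B)) g≢c (∈∧∉⇒≢ g∈C w∉C)
          g≢d (∈∧∉⇒≢ g∈C e∉C) d∈C∖B d≢c e∉C e≢w
  ... | inj₂ onlyCD with otherThan₂? (_∈? B) b₁ b₂
  ...   | inj₁ (h , h∈B , h≢b₁ , h≢b₂) =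
    h , removeAt-Loose h≢b₁ h≢b₂ (∈∧∉⇒≢ h∈B c∉B) (∈∧∉⇒≢ h∈B w∉B)
          (∈∧∉⇒≢ h∈B d∉B) (∈∧∉⇒≢ (B⊆C h∈B) e∉C) d∈C∖B d≢c e∉C e≢w
  ...   | inj₂ onlyB =
    d , removeAt-Tight (≢-sym (∈∧∉⇒≢ b₁∈B d∉B)) (≢-sym (∈∧∉⇒≢ b₂∈B d∉B)) d≢c (∈∧∉⇒≢ d∈C w∉C)
          onlyC (λ x _ → onlyB x)
    where
    onlyC : ∀ x → d ≢ x → x ∈ C × x ∉ B → x ≡ c
    onlyC x d≢x x∈C∖B = [ id , (λ x≡d → ⊥-elim (d≢x (sym x≡d))) ] (onlyCD x x∈C∖B)

restrict-Generated : ∀ {H : Family (suc n)} {B C} p → H ≗ Generated B C →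
  restrict p H ≗ Generated (removeAt B p) (removeAt C p)
restrict-Generated {B = B} {C} p H≗ Z = trans (H≗ (insertAt Z p outside)) (Generated-insertAt B C p Z)

theorem13p19 : ∀ (n : ℕ) (H : Family (suc n)) →
    4 < suc n → mGU 2 (suc n) H →
    ∃[ p ] mGU 2 n (restrict p H)
theorem13p19 n H 4<n+1 m =
  let open Classification (classify m)
      open AdmissibleLadder admissible
      p , A′ = removable ladder 4<n+1 shape
  in p , Admissible⇒mGU (restrict-Generated p H≗) A′
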